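{- Fix an integer $d\geq 1$. For integers $k\geq -1$, define the polynomial \[ p_{d,k}(n)=3d\binom{n+k}{1+k}+\sum_{i=1}^{k}(3i+2)\binom{n-1+k-i}{k-i} \] (so $p_{d,-1}(n)=3d$ and $p_{d,0}(n)=3dn$). Define a sequence $(a_m)_{m\geq 1}$ as follows: writing $m=3dn+r$ with integers $n\geq 0$ and $0\leq r<3d$, \[ a_{m}=\begin{cases} 3d-2 & \text{if } m=1,\\ 0 & \text{if } m=2,\\ p_{d,r/3}(n) & \text{if } r\equiv 0 \pmod 3,\\ 3d & \text{if } r\equiv 1 \pmod 3 \text{ and } m>2,\\ 3 & \text{if } r\equiv 2 \pmod 3,\ r\neq 3d-1, \text{ and } m>2,\\ 2 & \text{if } r=3d-1 \text{ and } m>2. \end{cases} \] Extend the sequence by setting $a_j=0$ for all integers $j\leq 0$. Then for every integer $m>3d+2$, \[ a_m=a_{m-a_{m-1}}+a_{m-a_{m-2}}, \] i.e. $(a_m)$ satisfies the Hofstadter $Q$-recurrence $Q(n)=Q(n-Q(n-1))+Q(n-Q(n-2))$ after an initial segment of length $3d+2$.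
   Context: Binomial coefficients are interpreted as polynomials in the top argument: for an integer $j\geq 0$, $\binom{x}{j}=\frac{x(x-1)\cdots(x-j+1)}{j!}$ (so, e.g., $\binom{ -1}{0}=1$ and $\binom{k}{k+1}=0$ for integers $k\geq 0$). Convention: terms of the sequence at nonpositive indices are defined to be $0$. -}

module Defs where

open import Data.Nat as ℕ using (ℕ; zero; suc; _!; NonZero)
open import Data.Nat.Properties using (_!≢0; m*n≢0)
open import Data.Integer as ℤ using (ℤ; +_; -[1+_]; _-_; _*_; _+_)
open import Data.Bool using (Bool; true; false; if_then_else_)

falling : ℤ → ℕ → ℤ
falling x zero    = + 1
falling x (suc j) = falling x j * (x - + j)

-- Binomial coefficient as a polynomial in the top argument:
-- binom x j = x (x-1) ... (x-j+1) / j!   (the division is exact).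
binom : ℤ → ℕ → ℤ
binom x j = ℤ._/_ (falling x j) (+ (j !)) {{j !≢0}}

sumFrom1 : ℕ → (ℕ → ℤ) → ℤ
sumFrom1 zero    f = + 0
sumFrom1 (suc k) f = sumFrom1 k f + f (suc k)

p : ℕ → ℕ → ℤ → ℤ
p d k n = (+ (3 ℕ.* d)) * binom (n + + k) (1 ℕ.+ k)
        + sumFrom1 k (λ i → + (3 ℕ.* i ℕ.+ 2) * binom (n - + 1 + + k - + i) (k ℕ.∸ i))

aPos : (d : ℕ) → .{{NonZero d}} → ℕ → ℤ
aPos d m =
  if m ℕ.≡ᵇ 1 then + (3 ℕ.* d ℕ.∸ 2) else
  if m ℕ.≡ᵇ 2 then + 0 else
  if (r ℕ.% 3) ℕ.≡ᵇ 0 then p d (r ℕ./ 3) (+ n) else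
  if (r ℕ.% 3) ℕ.≡ᵇ 1 then + (3 ℕ.* d) else
  if r ℕ.≡ᵇ (3 ℕ.* d ℕ.∸ 1) then + 2 else + 3
  where
  instance
    nz3d : NonZero (3 ℕ.* d)
    nz3d = m*n≢0 3 d
  n r : ℕ
  n = m ℕ./ (3 ℕ.* d)
  r = m ℕ.% (3 ℕ.* d)

a : (d : ℕ) → .{{NonZero d}} → ℤ → ℤ
a d (+ zero)    = + 0
a d (+ suc m)   = aPos d (suc m)
a d -[1+ _ ]    = + 0

-- Write m = 3dn + 3j + s with 0 ≤ s < 3 and 0 ≤ j < d. At natural n the binomials of p_{d,j}
-- are multiset coefficients C(n-1+t, t), and Pascal's rule for these gives
-- p_{d,j+1}(n+1) = p_{d,j}(n+1) + p_{d,j+1}(n), while p_{d,j+1}(n) ≥ 3dn + 3j + 5.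
-- Once m > 3d + 2, a_{m-1} and a_{m-2} are known in each of the six kinds of
-- position, and the recurrence becomes: Pascal's rule (s = 0, looking back 3 and
-- 3d); a_m = a_{m-3} or a_{m-3d} with the other term at an index where a vanishes,
-- either ≤ 0 because p_{d,j}(n) exceeds m, or 2 (s = 1, 2); or, for j = 0,
-- 3d(n+2) = 3d + 3d(n+1) and 3d = (3d - 2) + 2 with a_1 = 3d - 2.

module Submission where

open import Defs
open import Data.Nat using (ℕ; NonZero)
open import Data.Integer using (ℤ; +_; _-_; _+_; _>_)
open import Relation.Binary.PropositionalEquality using (_≡_)

open import Data.Nat as ℕ using (zero; suc; s≤s⁻¹; s<s⁻¹; >-nonZero⁻¹; _!; _∸_; _≤_; _<_; _≡ᵇ_; z≤n; s≤s)
open import Data.Nat.Properties as ℕ using (_!≢0)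
open import Data.Nat.DivMod using (_/_; _%_; m%n<n; m<n*o⇒m/o<n; m≡m%n+[m/n]*n; 0/n≡0; m*n/n≡m; m*n%n≡0; m<n⇒m/n≡0; m<n⇒m%n≡m; [m+kn]%n≡m%n; +-distrib-/-∣ʳ)
open import Data.Nat.Divisibility using (n∣m*n)
open import Data.Nat.Combinatorics using (_C_; k>n⇒nCk≡0; nC1≡n; nCk+nC[k+1]≡[n+1]C[k+1])
open import Data.Nat.Combinatorics.Base using (_P′_; _C′_)
open import Data.Nat.Combinatorics.Specification using (nC′k≡n!/k![n-k]!; nCk≡n!/k![n-k]!)
open import Data.Integer as ℤ using (-_; -[1+_])
open import Data.Integer.Properties as ℤ using (m-n≡m⊖n; ⊖-≥; ⊖-≤; pos-*)
open import Data.Integer.DivMod using (_/ℕ_; div-pos-is-/ℕ)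
import Data.Integer.Tactic.RingSolver as ℤ-Solver
import Data.Nat.Tactic.RingSolver as ℕ-Solver
open import Data.Sum using (inj₁; inj₂)
open import Data.Bool using (if_then_else_)
open import Function using (_∘_)
open import Algebra.Properties.CommutativeSemigroup ℕ.+-commutativeSemigroup
  using (x∙yz≈y∙xz) renaming (interchange to +-interchange)
open import Relation.Nullary using (contradiction)
open import Relation.Nullary.Decidable using (dec-true; dec-false)
open import Relation.Binary.PropositionalEquality using (_≢_; refl; sym; trans; cong; cong₂; subst; module ≡-Reasoning)

-- Binomial coefficients at natural arguments

pos-∸ : ∀ {m n} → n ≤ m → + m - + n ≡ + (m ∸ n)
pos-∸ {m} {n} n≤m = trans (m-n≡m⊖n m n) (⊖-≥ n≤m)

P′-vanishes : ∀ {n k} → n < k → n P′ k ≡ 0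
P′-vanishes {n} {suc k} (s≤s n≤k) = cong (ℕ._* (n P′ k)) (ℕ.m≤n⇒m∸n≡0 n≤k)

falling-pos : ∀ n k → falling (+ n) k ≡ + (n P′ k)
falling-pos n zero    = refl
falling-pos n (suc k) = begin
  falling (+ n) k ℤ.* (+ n - + k)   ≡⟨ cong (ℤ._* (+ n - + k)) (falling-pos n k) ⟩
  + (n P′ k) ℤ.* (+ n - + k)        ≡⟨ last-factor ⟩
  + ((n ∸ k) ℕ.* (n P′ k))          ∎
  where
  open ≡-Reasoning
  last-factor : + (n P′ k) ℤ.* (+ n - + k) ≡ + ((n ∸ k) ℕ.* (n P′ k))
  last-factor with ℕ.≤-<-connex k n
  ... | inj₁ k≤n = begin
    + (n P′ k) ℤ.* (+ n - + k)    ≡⟨ cong (+ (n P′ k) ℤ.*_) (pos-∸ k≤n) ⟩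
    + (n P′ k) ℤ.* + (n ∸ k)      ≡⟨ sym (pos-* (n P′ k) (n ∸ k)) ⟩
    + ((n P′ k) ℕ.* (n ∸ k))      ≡⟨ cong +_ (ℕ.*-comm (n P′ k) (n ∸ k)) ⟩
    + ((n ∸ k) ℕ.* (n P′ k))      ∎
  ... | inj₂ n<k rewrite P′-vanishes n<k | ℕ.*-zeroʳ (n ∸ k) = ℤ.*-zeroˡ (+ n - + k)

C′≡C : ∀ n k → n C′ k ≡ n C k
C′≡C n k with ℕ.≤-<-connex k n
... | inj₁ k≤n = trans (nC′k≡n!/k![n-k]! k≤n) (sym (nCk≡n!/k![n-k]! k≤n))
... | inj₂ n<k = begin
  (n P′ k) / k ! ≡⟨ cong (_/ k !) (P′-vanishes n<k) ⟩
  0 / k !        ≡⟨ 0/n≡0 (k !) ⟩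
  0              ≡⟨ sym (k>n⇒nCk≡0 n<k) ⟩
  n C k          ∎
  where
  open ≡-Reasoning
  instance _ = k !≢0

binom-pos : ∀ n k → binom (+ n) k ≡ + (n C k)
binom-pos n k = begin
  binom (+ n) k          ≡⟨ div-pos-is-/ℕ (falling (+ n) k) (k !) ⟩
  falling (+ n) k /ℕ k ! ≡⟨ cong (_/ℕ k !) (falling-pos n k) ⟩
  + (n C′ k)             ≡⟨ cong +_ (C′≡C n k) ⟩
  + (n C k)              ∎
  where
  open ≡-Reasoning
  instance _ = k !≢0

-- Multiset coefficients C(n-1+t, t), defined without subtraction so that n = 0 needs no care.

multichoose : ℕ → ℕ → ℕ
multichoose n zero    = 1
multichoose n (suc t) = (n ℕ.+ t) C suc t

multichoose-one : ∀ n → multichoose n 1 ≡ n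
multichoose-one n = trans (cong (_C 1) (ℕ.+-identityʳ n)) (nC1≡n n)

multichoose-sucˡ : ∀ n t → multichoose (suc n) t ≡ (n ℕ.+ t) C t
multichoose-sucˡ n zero    = refl
multichoose-sucˡ n (suc t) = cong (_C suc t) (sym (ℕ.+-suc n t))

multichoose-pascal : ∀ n t →
  multichoose (suc n) (suc t) ≡ multichoose (suc n) t ℕ.+ multichoose n (suc t)
multichoose-pascal n t = begin
  suc (n ℕ.+ t) C suc t                           ≡⟨ sym (nCk+nC[k+1]≡[n+1]C[k+1] (n ℕ.+ t) t) ⟩
  (n ℕ.+ t) C t ℕ.+ (n ℕ.+ t) C suc t             ≡⟨ cong (ℕ._+ multichoose n (suc t)) (sym (multichoose-sucˡ n t)) ⟩
  multichoose (suc n) t ℕ.+ multichoose n (suc t) ∎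
  where open ≡-Reasoning

n≤multichoose : ∀ n t → n ≤ multichoose n (suc t)
n≤multichoose n       zero    = ℕ.≤-reflexive (sym (multichoose-one n))
n≤multichoose zero    (suc t) = z≤n
n≤multichoose (suc n) (suc t) = ℕ.≤-trans (n≤multichoose (suc n) t)
  (subst (multichoose (suc n) (suc t) ≤_) (sym (multichoose-pascal n (suc t))) (ℕ.m≤m+n _ _))

binom-multichoose : ∀ n t → binom (+ n - + 1 + + t) t ≡ + multichoose n t
binom-multichoose n zero    = refl
binom-multichoose n (suc t) = trans (cong (λ x → binom x (suc t)) top) (binom-pos (n ℕ.+ t) (suc t))
  where
  shift : ∀ x y → x - + 1 + (+ 1 + y) ≡ x + y
  shift = ℤ-Solver.solve-∀
  top : + n - + 1 + + suc t ≡ + (n ℕ.+ t)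
  top = shift (+ n) (+ t)

binom-summand : ∀ n k i → binom (+ n - + 1 + + k - + i) (k ∸ i) ≡ + multichoose n (k ∸ i)
binom-summand n k i with ℕ.≤-<-connex i k
... | inj₁ i≤k = trans (cong (λ x → binom x (k ∸ i)) top) (binom-multichoose n (k ∸ i))
  where
  top : + n - + 1 + + k - + i ≡ + n - + 1 + + (k ∸ i)
  top = trans (ℤ.+-assoc (+ n - + 1) (+ k) (- + i)) (cong (_+_ (+ n - + 1)) (pos-∸ i≤k))
... | inj₂ k<i rewrite ℕ.m≤n⇒m∸n≡0 (ℕ.<⇒≤ k<i) = refl

-- The polynomials p over ℕ

∑₁ : ℕ → (ℕ → ℕ) → ℕ
∑₁ zero    f = 0
∑₁ (suc k) f = ∑₁ k f ℕ.+ f (suc k)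

sumFrom1-pos : ∀ k (f : ℕ → ℤ) (g : ℕ → ℕ) → (∀ i → f i ≡ + g i) → sumFrom1 k f ≡ + ∑₁ k g
sumFrom1-pos zero    f g f≡g = refl
sumFrom1-pos (suc k) f g f≡g = cong₂ _+_ (sumFrom1-pos k f g f≡g) (f≡g (suc k))

∑₁-cong : ∀ k {f g : ℕ → ℕ} → (∀ i → i ≤ k → f i ≡ g i) → ∑₁ k f ≡ ∑₁ k g
∑₁-cong zero    f≡g = refl
∑₁-cong (suc k) f≡g = cong₂ ℕ._+_ (∑₁-cong k (λ i i≤k → f≡g i (ℕ.m≤n⇒m≤1+n i≤k))) (f≡g (suc k) ℕ.≤-refl)

∑₁-distrib-+ : ∀ k (f g : ℕ → ℕ) → ∑₁ k (λ i → f i ℕ.+ g i) ≡ ∑₁ k f ℕ.+ ∑₁ k g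
∑₁-distrib-+ zero    f g = refl
∑₁-distrib-+ (suc k) f g = trans (cong (ℕ._+ (f (suc k) ℕ.+ g (suc k))) (∑₁-distrib-+ k f g))
  (+-interchange (∑₁ k f) (∑₁ k g) (f (suc k)) (g (suc k)))

pℕ : ℕ → ℕ → ℕ → ℕ
pℕ d k n = 3 ℕ.* d ℕ.* multichoose n (suc k) ℕ.+ ∑₁ k (λ i → (3 ℕ.* i ℕ.+ 2) ℕ.* multichoose n (k ∸ i))

p-pos : ∀ d k n → p d k (+ n) ≡ + pℕ d k n
p-pos d k n = begin
  + (3 ℕ.* d) ℤ.* binom (+ (n ℕ.+ k)) (suc k) + sumFrom1 k _
    ≡⟨ cong₂ _+_ (cong (+ (3 ℕ.* d) ℤ.*_) (binom-pos (n ℕ.+ k) (suc k))) (sumFrom1-pos k _ _ summand) ⟩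
  + (3 ℕ.* d) ℤ.* + multichoose n (suc k) + + ∑₁ k _
    ≡⟨ cong (ℤ._+ + ∑₁ k _) (sym (pos-* (3 ℕ.* d) (multichoose n (suc k)))) ⟩
  + pℕ d k n ∎
  where
  open ≡-Reasoning
  summand : ∀ i → + (3 ℕ.* i ℕ.+ 2) ℤ.* binom (+ n - + 1 + + k - + i) (k ∸ i)
                ≡ + ((3 ℕ.* i ℕ.+ 2) ℕ.* multichoose n (k ∸ i))
  summand i = trans (cong (+ (3 ℕ.* i ℕ.+ 2) ℤ.*_) (binom-summand n k i))
    (sym (pos-* (3 ℕ.* i ℕ.+ 2) (multichoose n (k ∸ i))))

pℕ-zero : ∀ d n → pℕ d 0 n ≡ 3 ℕ.* d ℕ.* n
pℕ-zero d n = trans (ℕ.+-identityʳ _) (cong (3 ℕ.* d ℕ.*_) (multichoose-one n))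

pℕ-zero-suc : ∀ d n → pℕ d 0 (suc n) ≡ 3 ℕ.* d ℕ.+ pℕ d 0 n
pℕ-zero-suc d n = trans (pℕ-zero d (suc n))
  (trans (ℕ.*-suc (3 ℕ.* d) n) (cong (3 ℕ.* d ℕ.+_) (sym (pℕ-zero d n))))

pℕ-pascal : ∀ d j n → pℕ d (suc j) (suc n) ≡ pℕ d j (suc n) ℕ.+ pℕ d (suc j) n
pℕ-pascal d j n = begin
  c ℕ.* multichoose (suc n) (suc (suc j)) ℕ.+ ∑₁ (suc j) F
    ≡⟨ cong₂ ℕ._+_ (cong (c ℕ.*_) (multichoose-pascal n (suc j))) sum-pascal ⟩
  c ℕ.* (multichoose (suc n) (suc j) ℕ.+ multichoose n (suc (suc j))) ℕ.+ (∑₁ j G ℕ.+ ∑₁ (suc j) H)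
    ≡⟨ cong (ℕ._+ (∑₁ j G ℕ.+ ∑₁ (suc j) H)) (ℕ.*-distribˡ-+ c _ _) ⟩
  c ℕ.* multichoose (suc n) (suc j) ℕ.+ c ℕ.* multichoose n (suc (suc j)) ℕ.+ (∑₁ j G ℕ.+ ∑₁ (suc j) H)
    ≡⟨ +-interchange (c ℕ.* multichoose (suc n) (suc j)) _ (∑₁ j G) (∑₁ (suc j) H) ⟩
  pℕ d j (suc n) ℕ.+ pℕ d (suc j) n ∎
  where
  open ≡-Reasoning
  c = 3 ℕ.* d
  w : ℕ → ℕ
  w i = 3 ℕ.* i ℕ.+ 2
  F G H : ℕ → ℕ
  F i = w i ℕ.* multichoose (suc n) (suc j ∸ i)
  G i = w i ℕ.* multichoose (suc n) (j ∸ i)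
  H i = w i ℕ.* multichoose n (suc j ∸ i)
  split : ∀ i → i ≤ j → F i ≡ G i ℕ.+ H i
  split i i≤j rewrite ℕ.+-∸-assoc 1 i≤j =
    trans (cong (w i ℕ.*_) (multichoose-pascal n (j ∸ i))) (ℕ.*-distribˡ-+ (w i) _ _)
  last : F (suc j) ≡ H (suc j)
  last rewrite ℕ.n∸n≡0 j = refl
  sum-pascal : ∑₁ (suc j) F ≡ ∑₁ j G ℕ.+ ∑₁ (suc j) H
  sum-pascal = begin
    ∑₁ j F ℕ.+ F (suc j)                  ≡⟨ cong₂ ℕ._+_ (∑₁-cong j split) last ⟩
    ∑₁ j (λ i → G i ℕ.+ H i) ℕ.+ H (suc j) ≡⟨ cong (ℕ._+ H (suc j)) (∑₁-distrib-+ j G H) ⟩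
    ∑₁ j G ℕ.+ ∑₁ j H ℕ.+ H (suc j)        ≡⟨ ℕ.+-assoc (∑₁ j G) _ _ ⟩
    ∑₁ j G ℕ.+ ∑₁ (suc j) H                ∎

pℕ-lower : ∀ d j n → 3 ℕ.* d ℕ.* n ℕ.+ (3 ℕ.* suc j ℕ.+ 2) ≤ pℕ d (suc j) n
pℕ-lower d j n = ℕ.+-mono-≤ (ℕ.*-monoʳ-≤ (3 ℕ.* d) (n≤multichoose n (suc j)))
  (ℕ.≤-trans (ℕ.≤-reflexive last) (ℕ.m≤n+m _ (∑₁ j (λ i → (3 ℕ.* i ℕ.+ 2) ℕ.* multichoose n (suc j ∸ i)))))
  where
  last : 3 ℕ.* suc j ℕ.+ 2 ≡ (3 ℕ.* suc j ℕ.+ 2) ℕ.* multichoose n (j ∸ j)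
  last rewrite ℕ.n∸n≡0 j = sym (ℕ.*-identityʳ _)

-- Values of the sequence

QRecurrence : (d : ℕ) .{{_ : NonZero d}} → ℤ → Set
QRecurrence d m = a d m ≡ a d (m - a d (m - + 1)) + a d (m - a d (m - + 2))

residue<block : ∀ {d s j} → s < 3 → j < d → s ℕ.+ j ℕ.* 3 < 3 ℕ.* d
residue<block {d} {s} {j} s<3 j<d = ℕ.≤-trans (ℕ.+-monoˡ-< (j ℕ.* 3) s<3)
  (subst (_≤ 3 ℕ.* d) (ℕ.*-comm 3 (suc j)) (ℕ.*-monoʳ-≤ 3 j<d))

module _ (d : ℕ) .{{_ : NonZero d}} where

  private instance
    3d≢0 : NonZero (3 ℕ.* d)
    3d≢0 = ℕ.m*n≢0 3 d

  a-nonpos : ∀ n → a d (- + n) ≡ + 0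
  a-nonpos zero    = refl
  a-nonpos (suc n) = refl

  a-∸ : ∀ M K → a d (+ M - + K) ≡ a d (+ (M ∸ K))
  a-∸ M K with ℕ.≤-<-connex K M
  ... | inj₁ K≤M = cong (a d) (pos-∸ K≤M)
  ... | inj₂ M<K rewrite ℕ.m≤n⇒m∸n≡0 (ℕ.<⇒≤ M<K) =
    trans (cong (a d) (trans (m-n≡m⊖n M K) (⊖-≤ (ℕ.<⇒≤ M<K)))) (a-nonpos (K ∸ M))

  recurrence-via : ∀ M {u v} → a d (+ (M ∸ 1)) ≡ + u → a d (+ (M ∸ 2)) ≡ + v →
    a d (+ M) ≡ a d (+ (M ∸ u)) + a d (+ (M ∸ v)) → QRecurrence d (+ M)
  recurrence-via M {u} {v} a[M-1] a[M-2] step = begin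
    a d (+ M)                                                 ≡⟨ step ⟩
    a d (+ (M ∸ u)) + a d (+ (M ∸ v))                         ≡⟨ sym (cong₂ _+_ (a-∸ M u) (a-∸ M v)) ⟩
    a d (+ M - + u) + a d (+ M - + v)                         ≡⟨ sym (cong₂ (λ x y → a d (+ M - x) + a d (+ M - y))
                                                                   (trans (a-∸ M 1) a[M-1]) (trans (a-∸ M 2) a[M-2])) ⟩
    a d (+ M - a d (+ M - + 1)) + a d (+ M - a d (+ M - + 2)) ∎
    where open ≡-Reasoning

  blockValue : ℕ → ℕ → ℤ
  blockValue n r =
    if r % 3 ≡ᵇ 0 then p d (r / 3) (+ n) else
    if r % 3 ≡ᵇ 1 then + (3 ℕ.* d) else
    if r ≡ᵇ 3 ℕ.* d ∸ 1 then + 2 else + 3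

  a-block : ∀ n r → r < 3 ℕ.* d → 3 ≤ r ℕ.+ n ℕ.* (3 ℕ.* d) →
    a d (+ (r ℕ.+ n ℕ.* (3 ℕ.* d))) ≡ blockValue n r
  a-block n r r<3d 3≤m = trans (a-from-3 _ 3≤m) (cong₂ blockValue quotient remainder)
    where
    a-from-3 : ∀ m → 3 ≤ m → a d (+ m) ≡ blockValue (m / (3 ℕ.* d)) (m % (3 ℕ.* d))
    a-from-3 (suc (suc (suc m))) _              = refl
    a-from-3 (suc (suc zero))    (s≤s (s≤s ()))
    a-from-3 (suc zero)          (s≤s ())
    remainder : (r ℕ.+ n ℕ.* (3 ℕ.* d)) % (3 ℕ.* d) ≡ r
    remainder = trans ([m+kn]%n≡m%n r n (3 ℕ.* d)) (m<n⇒m%n≡m r<3d)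
    quotient : (r ℕ.+ n ℕ.* (3 ℕ.* d)) / (3 ℕ.* d) ≡ n
    quotient = begin
      (r ℕ.+ n ℕ.* (3 ℕ.* d)) / (3 ℕ.* d)           ≡⟨ +-distrib-/-∣ʳ r {d = 3 ℕ.* d} (n∣m*n n) ⟩
      r / (3 ℕ.* d) ℕ.+ n ℕ.* (3 ℕ.* d) / (3 ℕ.* d) ≡⟨ cong₂ ℕ._+_ (m<n⇒m/n≡0 r<3d) (m*n/n≡m n (3 ℕ.* d)) ⟩
      n                                             ∎
      where open ≡-Reasoning

  slot : ℕ → ℕ → ℕ → ℕ
  slot s j n = s ℕ.+ j ℕ.* 3 ℕ.+ n ℕ.* (3 ℕ.* d)

  slot-decomposition : ∀ m → m ≡ slot (m % (3 ℕ.* d) % 3) (m % (3 ℕ.* d) / 3) (m / (3 ℕ.* d))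
  slot-decomposition m = trans (m≡m%n+[m/n]*n m (3 ℕ.* d))
    (cong (ℕ._+ m / (3 ℕ.* d) ℕ.* (3 ℕ.* d)) (m≡m%n+[m/n]*n (m % (3 ℕ.* d)) 3))

  slot-∸-block : ∀ s j n → slot s j (suc n) ∸ 3 ℕ.* d ≡ slot s j n
  slot-∸-block s j n =
    trans (cong (_∸ 3 ℕ.* d) (x∙yz≈y∙xz (s ℕ.+ j ℕ.* 3) (3 ℕ.* d) (n ℕ.* (3 ℕ.* d))))
          (ℕ.m+n∸m≡n (3 ℕ.* d) (slot s j n))

  3≤slot-sucₙ : ∀ s j n → 3 ≤ slot s j (suc n)
  3≤slot-sucₙ s j n = ℕ.≤-trans (ℕ.m≤m*n 3 d)
    (ℕ.≤-trans (ℕ.m≤m+n (3 ℕ.* d) (n ℕ.* (3 ℕ.* d))) (ℕ.m≤n+m _ (s ℕ.+ j ℕ.* 3)))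

  3≤slot-sucⱼ : ∀ s j n → 3 ≤ slot s (suc j) n
  3≤slot-sucⱼ s j n = ℕ.≤-trans (ℕ.m≤m+n 3 (j ℕ.* 3))
    (ℕ.≤-trans (ℕ.m≤n+m _ s) (ℕ.m≤m+n _ (n ℕ.* (3 ℕ.* d))))

  slot-∸-pℕ-zero : ∀ s n → slot s 0 n ∸ pℕ d 0 n ≡ s
  slot-∸-pℕ-zero s n =
    trans (cong (slot s 0 n ∸_) (trans (pℕ-zero d n) (ℕ.*-comm (3 ℕ.* d) n)))
          (trans (ℕ.m+n∸n≡m (s ℕ.+ 0) (n ℕ.* (3 ℕ.* d))) (ℕ.+-identityʳ s))

  slot-≤-pℕ : ∀ j n → slot 2 (suc j) n ≤ pℕ d (suc j) n
  slot-≤-pℕ j n = subst (_≤ pℕ d (suc j) n) (sym (shape d j n)) (pℕ-lower d j n)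
    where
    shape : ∀ x j n → 2 ℕ.+ suc j ℕ.* 3 ℕ.+ n ℕ.* (3 ℕ.* x) ≡ 3 ℕ.* x ℕ.* n ℕ.+ (3 ℕ.* suc j ℕ.+ 2)
    shape = ℕ-Solver.solve-∀

  a-slot0 : ∀ j n → j < d → 3 ≤ slot 0 j n → a d (+ slot 0 j n) ≡ + pℕ d j n
  a-slot0 j n j<d 3≤m = trans (a-block n (j ℕ.* 3) (residue<block (s≤s z≤n) j<d) 3≤m)
    (trans value (p-pos d j n))
    where
    value : blockValue n (j ℕ.* 3) ≡ p d j (+ n)
    value rewrite m*n%n≡0 j 3 {{_}} | m*n/n≡m j 3 {{_}} = refl

  a-slot1 : ∀ j n → j < d → 3 ≤ slot 1 j n → a d (+ slot 1 j n) ≡ + (3 ℕ.* d)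
  a-slot1 j n j<d 3≤m =
    trans (a-block n (1 ℕ.+ j ℕ.* 3) (residue<block (s≤s (s≤s z≤n)) j<d) 3≤m) value
    where
    value : blockValue n (1 ℕ.+ j ℕ.* 3) ≡ + (3 ℕ.* d)
    value rewrite [m+kn]%n≡m%n 1 j 3 {{_}} = refl

  a-slot2 : ∀ j n → j < d → 3 ≤ slot 2 j n →
    a d (+ slot 2 j n) ≡ (if 2 ℕ.+ j ℕ.* 3 ≡ᵇ 3 ℕ.* d ∸ 1 then + 2 else + 3)
  a-slot2 j n j<d 3≤m =
    trans (a-block n (2 ℕ.+ j ℕ.* 3) (residue<block (s≤s (s≤s (s≤s z≤n))) j<d) 3≤m) value
    where
    value : blockValue n (2 ℕ.+ j ℕ.* 3) ≡ (if 2 ℕ.+ j ℕ.* 3 ≡ᵇ 3 ℕ.* d ∸ 1 then + 2 else + 3)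
    value rewrite [m+kn]%n≡m%n 2 j 3 {{_}} = refl

  a-slot2-periodic : ∀ j n → j < d → 3 ≤ slot 2 j n → a d (+ slot 2 j (suc n)) ≡ a d (+ slot 2 j n)
  a-slot2-periodic j n j<d 3≤m =
    trans (a-slot2 j (suc n) j<d (3≤slot-sucₙ 2 j n)) (sym (a-slot2 j n j<d 3≤m))

  a-slot2-inner : ∀ j n → suc j < d → 3 ≤ slot 2 j n → a d (+ slot 2 j n) ≡ + 3
  a-slot2-inner j n 1+j<d 3≤m = trans (a-slot2 j n (ℕ.<-trans (ℕ.n<1+n j) 1+j<d) 3≤m)
    (cong (if_then + 2 else + 3) (dec-false (2 ℕ.+ j ℕ.* 3 ℕ.≟ 3 ℕ.* d ∸ 1) not-last))
    where
    not-last : 2 ℕ.+ j ℕ.* 3 ≢ 3 ℕ.* d ∸ 1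
    not-last eq = ℕ.<⇒≢ 1+j<d (ℕ.*-cancelʳ-≡ (suc j) d 3 (begin
      suc j ℕ.* 3        ≡⟨ cong suc eq ⟩
      suc (3 ℕ.* d ∸ 1)  ≡⟨ ℕ.m+[n∸m]≡n (>-nonZero⁻¹ (3 ℕ.* d)) ⟩
      3 ℕ.* d            ≡⟨ ℕ.*-comm 3 d ⟩
      d ℕ.* 3            ∎))
      where open ≡-Reasoning

-- The recurrence, position by position

module _ (e : ℕ) where

  private
    d : ℕ
    d = suc e

    0<d : 0 < d
    0<d = s≤s z≤n

  a-slot2-last : ∀ n → 3 ≤ slot d 2 e n → a d (+ slot d 2 e n) ≡ + 2
  a-slot2-last n 3≤m = trans (a-slot2 d e n ℕ.≤-refl 3≤m)
    (cong (if_then + 2 else + 3) (dec-true (2 ℕ.+ e ℕ.* 3 ℕ.≟ 3 ℕ.* d ∸ 1) (cong (_∸ 1) (shape e))))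
    where
    shape : ∀ x → suc (2 ℕ.+ x ℕ.* 3) ≡ 3 ℕ.* suc x
    shape = ℕ-Solver.solve-∀

  block-start≡1+last-slot : ∀ n → slot d 0 0 (suc n) ≡ suc (slot d 2 e n)
  block-start≡1+last-slot = shape e
    where
    shape : ∀ x n → suc n ℕ.* (3 ℕ.* suc x) ≡ suc (2 ℕ.+ x ℕ.* 3 ℕ.+ n ℕ.* (3 ℕ.* suc x))
    shape = ℕ-Solver.solve-∀

  a-block-start-∸1 : ∀ n → a d (+ (slot d 0 0 (suc (suc n)) ∸ 1)) ≡ + 2
  a-block-start-∸1 n = trans (cong (λ x → a d (+ (x ∸ 1))) (block-start≡1+last-slot (suc n)))
    (a-slot2-last (suc n) (3≤slot-sucₙ d 2 e n))

  a-block-start-∸2 : ∀ n → a d (+ (slot d 0 0 (suc (suc n)) ∸ 2)) ≡ + (3 ℕ.* d)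
  a-block-start-∸2 n = trans (cong (λ x → a d (+ (x ∸ 2))) (block-start≡1+last-slot (suc n)))
    (a-slot1 d e (suc n) ℕ.≤-refl (3≤slot-sucₙ d 1 e n))

  recurrence-P-start : ∀ n → QRecurrence d (+ slot d 0 0 (suc (suc n)))
  recurrence-P-start n = recurrence-via d M (a-block-start-∸1 n) (a-block-start-∸2 n) (begin
    a d (+ M)                                ≡⟨ a-slot0 d 0 (suc (suc n)) 0<d (3≤slot-sucₙ d 0 0 (suc n)) ⟩
    + pℕ d 0 (suc (suc n))                   ≡⟨ cong +_ (pℕ-zero-suc d (suc n)) ⟩
    + (3 ℕ.* d) + + pℕ d 0 (suc n)           ≡⟨ sym (cong₂ _+_ (a-block-start-∸2 n) a[M-3d]) ⟩
    a d (+ (M ∸ 2)) + a d (+ (M ∸ 3 ℕ.* d)) ∎)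
    where
    open ≡-Reasoning
    M = slot d 0 0 (suc (suc n))
    a[M-3d] : a d (+ (M ∸ 3 ℕ.* d)) ≡ + pℕ d 0 (suc n)
    a[M-3d] = trans (cong (a d ∘ +_) (slot-∸-block d 0 0 (suc n)))
      (a-slot0 d 0 (suc n) 0<d (3≤slot-sucₙ d 0 0 n))

  recurrence-P : ∀ j n → j < e → QRecurrence d (+ slot d 0 (suc j) (suc n))
  recurrence-P j n j<e = recurrence-via d M
    (a-slot2-inner d j (suc n) (s≤s j<e) (3≤slot-sucₙ d 2 j n))
    (a-slot1 d j (suc n) j<d (3≤slot-sucₙ d 1 j n)) (begin
    a d (+ M)                                ≡⟨ a-slot0 d (suc j) (suc n) (s≤s j<e) (3≤slot-sucₙ d 0 (suc j) n) ⟩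
    + pℕ d (suc j) (suc n)                   ≡⟨ cong +_ (pℕ-pascal d j n) ⟩
    + pℕ d j (suc n) + + pℕ d (suc j) n      ≡⟨ sym (cong₂ _+_ a[M-3] a[M-3d]) ⟩
    a d (+ (M ∸ 3)) + a d (+ (M ∸ 3 ℕ.* d)) ∎)
    where
    open ≡-Reasoning
    M = slot d 0 (suc j) (suc n)
    j<d = ℕ.m<n⇒m<1+n j<e
    a[M-3] : a d (+ (M ∸ 3)) ≡ + pℕ d j (suc n)
    a[M-3] = a-slot0 d j (suc n) j<d (3≤slot-sucₙ d 0 j n)
    a[M-3d] : a d (+ (M ∸ 3 ℕ.* d)) ≡ + pℕ d (suc j) n
    a[M-3d] = trans (cong (a d ∘ +_) (slot-∸-block d 0 (suc j) n))
      (a-slot0 d (suc j) n (s≤s j<e) (3≤slot-sucⱼ d 0 j n))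

  recurrence-D-start : ∀ n → QRecurrence d (+ slot d 1 0 (suc (suc n)))
  recurrence-D-start n = recurrence-via d M
    (a-slot0 d 0 (suc (suc n)) 0<d (3≤slot-sucₙ d 0 0 (suc n))) (a-block-start-∸1 n) (begin
    a d (+ M)                                ≡⟨ a-slot1 d 0 (suc (suc n)) 0<d (3≤slot-sucₙ d 1 0 (suc n)) ⟩
    + (3 ℕ.* d)                              ≡⟨ cong +_ (sym (ℕ.m∸n+n≡m 2≤3d)) ⟩
    + (3 ℕ.* d ∸ 2) + + 2                    ≡⟨ sym (cong₂ _+_ a[M-p] (a-block-start-∸1 n)) ⟩
    a d (+ (M ∸ pℕ d 0 (suc (suc n)))) + a d (+ (M ∸ 2)) ∎)
    where
    open ≡-Reasoning
    M = slot d 1 0 (suc (suc n))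
    2≤3d : 2 ≤ 3 ℕ.* d
    2≤3d = ℕ.≤-trans (ℕ.n≤1+n 2) (ℕ.m≤m*n 3 d)
    a[M-p] : a d (+ (M ∸ pℕ d 0 (suc (suc n)))) ≡ a d (+ 1)
    a[M-p] = cong (a d ∘ +_) (slot-∸-pℕ-zero d 1 (suc (suc n)))

  recurrence-D : ∀ j n → j < e → QRecurrence d (+ slot d 1 (suc j) (suc n))
  recurrence-D j n j<e = recurrence-via d M
    (a-slot0 d (suc j) (suc n) (s≤s j<e) (3≤slot-sucₙ d 0 (suc j) n))
    (a-slot2-inner d j (suc n) (s≤s j<e) (3≤slot-sucₙ d 2 j n)) (begin
    a d (+ M)                                ≡⟨ a-slot1 d (suc j) (suc n) (s≤s j<e) (3≤slot-sucₙ d 1 (suc j) n) ⟩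
    + (3 ℕ.* d)                              ≡⟨ sym (ℤ.+-identityˡ _) ⟩
    + 0 + + (3 ℕ.* d)                        ≡⟨ sym (cong₂ _+_ (cong (a d ∘ +_) M∸p≡0) a[M-3]) ⟩
    a d (+ (M ∸ pℕ d (suc j) (suc n))) + a d (+ (M ∸ 3)) ∎)
    where
    open ≡-Reasoning
    M = slot d 1 (suc j) (suc n)
    M∸p≡0 : M ∸ pℕ d (suc j) (suc n) ≡ 0
    M∸p≡0 = ℕ.m≤n⇒m∸n≡0 (ℕ.≤-trans (ℕ.n≤1+n M) (slot-≤-pℕ d j (suc n)))
    a[M-3] : a d (+ (M ∸ 3)) ≡ + (3 ℕ.* d)
    a[M-3] = a-slot1 d j (suc n) (ℕ.m<n⇒m<1+n j<e) (3≤slot-sucₙ d 1 j n)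

  recurrence-small-start : ∀ n → QRecurrence d (+ slot d 2 0 (suc (suc n)))
  recurrence-small-start n = recurrence-via d M
    (a-slot1 d 0 (suc (suc n)) 0<d (3≤slot-sucₙ d 1 0 (suc n)))
    (a-slot0 d 0 (suc (suc n)) 0<d (3≤slot-sucₙ d 0 0 (suc n))) (begin
    a d (+ M)                                ≡⟨ a-slot2-periodic d 0 (suc n) 0<d (3≤slot-sucₙ d 2 0 n) ⟩
    a d (+ slot d 2 0 (suc n))               ≡⟨ sym (ℤ.+-identityʳ _) ⟩
    a d (+ slot d 2 0 (suc n)) + + 0         ≡⟨ sym (cong₂ _+_ a[M-3d] a[M-p]) ⟩
    a d (+ (M ∸ 3 ℕ.* d)) + a d (+ (M ∸ pℕ d 0 (suc (suc n)))) ∎)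
    where
    open ≡-Reasoning
    M = slot d 2 0 (suc (suc n))
    a[M-3d] : a d (+ (M ∸ 3 ℕ.* d)) ≡ a d (+ slot d 2 0 (suc n))
    a[M-3d] = cong (a d ∘ +_) (slot-∸-block d 2 0 (suc n))
    a[M-p] : a d (+ (M ∸ pℕ d 0 (suc (suc n)))) ≡ a d (+ 2)
    a[M-p] = cong (a d ∘ +_) (slot-∸-pℕ-zero d 2 (suc (suc n)))

  recurrence-small : ∀ j n → j < e → QRecurrence d (+ slot d 2 (suc j) (suc n))
  recurrence-small j n j<e = recurrence-via d M
    (a-slot1 d (suc j) (suc n) (s≤s j<e) (3≤slot-sucₙ d 1 (suc j) n))
    (a-slot0 d (suc j) (suc n) (s≤s j<e) (3≤slot-sucₙ d 0 (suc j) n)) (begin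
    a d (+ M)                                ≡⟨ a-slot2-periodic d (suc j) n (s≤s j<e) (3≤slot-sucⱼ d 2 j n) ⟩
    a d (+ slot d 2 (suc j) n)               ≡⟨ sym (ℤ.+-identityʳ _) ⟩
    a d (+ slot d 2 (suc j) n) + + 0         ≡⟨ sym (cong₂ _+_ a[M-3d] (cong (a d ∘ +_) M∸p≡0)) ⟩
    a d (+ (M ∸ 3 ℕ.* d)) + a d (+ (M ∸ pℕ d (suc j) (suc n))) ∎)
    where
    open ≡-Reasoning
    M = slot d 2 (suc j) (suc n)
    a[M-3d] : a d (+ (M ∸ 3 ℕ.* d)) ≡ a d (+ slot d 2 (suc j) n)
    a[M-3d] = cong (a d ∘ +_) (slot-∸-block d 2 (suc j) n)
    M∸p≡0 : M ∸ pℕ d (suc j) (suc n) ≡ 0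
    M∸p≡0 = ℕ.m≤n⇒m∸n≡0 (slot-≤-pℕ d j (suc n))

  recurrence-slot : ∀ s j n → s < 3 → j < d → 3 ℕ.* d ℕ.+ 2 < slot d s j n →
    QRecurrence d (+ slot d s j n)
  recurrence-slot s j zero s<3 j<d 3d+2<m = contradiction first-block (ℕ.<⇒≱ 3d+2<m)
    where
    first-block : slot d s j 0 ≤ 3 ℕ.* d ℕ.+ 2
    first-block = ℕ.≤-trans (ℕ.≤-reflexive (ℕ.+-identityʳ (s ℕ.+ j ℕ.* 3)))
      (ℕ.≤-trans (ℕ.<⇒≤ (residue<block s<3 j<d)) (ℕ.m≤m+n (3 ℕ.* d) 2))
  recurrence-slot s zero (suc zero) s<3 _ 3d+2<m = contradiction second-block-start (ℕ.<⇒≱ 3d+2<m)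
    where
    shape : ∀ x s → s ℕ.+ 0 ℕ.* 3 ℕ.+ 1 ℕ.* (3 ℕ.* x) ≡ 3 ℕ.* x ℕ.+ s
    shape = ℕ-Solver.solve-∀
    second-block-start : slot d s 0 1 ≤ 3 ℕ.* d ℕ.+ 2
    second-block-start = subst (_≤ 3 ℕ.* d ℕ.+ 2) (sym (shape d s)) (ℕ.+-monoʳ-≤ (3 ℕ.* d) (s≤s⁻¹ s<3))
  recurrence-slot 0 zero    (suc (suc n)) _ _   _ = recurrence-P-start n
  recurrence-slot 1 zero    (suc (suc n)) _ _   _ = recurrence-D-start n
  recurrence-slot 2 zero    (suc (suc n)) _ _   _ = recurrence-small-start n
  recurrence-slot 0 (suc j) (suc n)       _ j<d _ = recurrence-P j n (s<s⁻¹ j<d)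
  recurrence-slot 1 (suc j) (suc n)       _ j<d _ = recurrence-D j n (s<s⁻¹ j<d)
  recurrence-slot 2 (suc j) (suc n)       _ j<d _ = recurrence-small j n (s<s⁻¹ j<d)
  recurrence-slot (suc (suc (suc _))) _ _ (s≤s (s≤s (s≤s ()))) _ _

  recurrence-beyond : ∀ m → 3 ℕ.* d ℕ.+ 2 < m → QRecurrence d (+ m)
  recurrence-beyond m 3d+2<m = subst (QRecurrence d ∘ +_) (sym m≡slot)
    (recurrence-slot s j n (m%n<n r 3) j<d (subst (3 ℕ.* d ℕ.+ 2 <_) m≡slot 3d+2<m))
    where
    r s j n : ℕ
    r = m % (3 ℕ.* d)
    s = r % 3
    j = r / 3
    n = m / (3 ℕ.* d)
    m≡slot : m ≡ slot d s j n
    m≡slot = slot-decomposition d m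
    j<d : j < d
    j<d = m<n*o⇒m/o<n (subst (r <_) (ℕ.*-comm 3 d) (m%n<n m (3 ℕ.* d)))

theorem1 : (d : ℕ) → .{{_ : NonZero d}} → (m : ℤ) → m > + (3 Data.Nat.* d Data.Nat.+ 2) →
    a d m ≡ a d (m - a d (m - + 1)) + a d (m - a d (m - + 2))
theorem1 (suc e) (+ m)    (ℤ.+<+ 3d+2<m) = recurrence-beyond e m 3d+2<m
theorem1 (suc e) -[1+ _ ] ()
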